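{- Let $G$ be a graph and $X$ a maximal $4$-independent set of $G$, and let $R:=V(G)\setminus N[X]$. If $(G,X)$ is reduced, i.e. $N^2(x)\cap R\neq\emptyset$ for every $x\in X$, then $|R|\ge |X|$.
   Context: A set $X\subseteq V(G)$ is $4$-independent if any two distinct vertices of $X$ are at distance at least $5$ in $G$; it is maximal if no vertex can be added while keeping it $4$-independent. $N[X]$ is $X$ together with all vertices having a neighbour in $X$; for a vertex $x$, $N^2(x)$ is the set of vertices other than $x$ at distance at most $2$ from $x$. -}

module Defs where

open import Data.Nat using (ℕ; zero; suc; _≤_)
open import Data.Fin using (Fin)
open import Data.Fin.Subset using (Subset; _∈_; _∉_; _∪_; ⁅_⁆)
open import Data.Product using (Σ; ∃; _×_; _,_)
open import Data.Sum using (_⊎_)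
open import Relation.Nullary using (¬_)
open import Relation.Binary.PropositionalEquality using (_≡_; _≢_)

record Graph (n : ℕ) : Set₁ where
  field
    Adj    : Fin n → Fin n → Set
    sym    : ∀ {u v} → Adj u v → Adj v u
    irrefl : ∀ {u} → ¬ Adj u u

module _ {n : ℕ} (G : Graph n) where
  open Graph G

  data Walk : ℕ → Fin n → Fin n → Set where
    here : ∀ {u} → Walk zero u u
    step : ∀ {k u w v} → Adj u w → Walk k w v → Walk (suc k) u v

  DistLE : ℕ → Fin n → Fin n → Set
  DistLE k u v = ∃ λ j → j ≤ k × Walk j u v

  FourIndependent : Subset n → Set
  FourIndependent X = ∀ x y → x ∈ X → y ∈ X → x ≢ y → ¬ DistLE 4 x y

  MaximalFourIndependent : Subset n → Set
  MaximalFourIndependent X =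
    FourIndependent X × (∀ v → v ∉ X → ¬ FourIndependent (⁅ v ⁆ ∪ X))

  InClosedNbhd : Subset n → Fin n → Set
  InClosedNbhd X v = v ∈ X ⊎ (∃ λ x → x ∈ X × Adj v x)

  InN2 : Fin n → Fin n → Set
  InN2 x v = v ≢ x × DistLE 2 x v

module Submission where

-- For every x ∈ X the reducedness hypothesis provides a
-- witness r(x) ∈ R with dist(x, r(x)) ≤ 2.  If r(x) = r(y) then
-- dist(x, y) ≤ dist(x, r(x)) + dist(r(y), y) ≤ 4, so 4-independence forces
-- x = y.  Hence r is an injection of X into R and |X| ≤ |R|.  (Neither the
-- maximality of X nor the description R = V(G) ∖ N[X] is needed for this
-- inequality; they only make R the set the paper is interested in.)

open import Defs
open import Data.Nat using (ℕ; zero; suc; pred; _+_; _≤_; z≤n; s≤s)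
open import Data.Nat.Properties using (+-mono-≤; module ≤-Reasoning)
open import Data.Fin using (Fin; zero; suc; _≟_)
open import Data.Fin.Subset using (Subset; _∈_; _∉_; ∣_∣; _-_; inside; outside)
open import Data.Fin.Subset.Properties
  using (p─⊥≡p; nonempty?; Empty-unique; ∣⊥∣≡0; x∈p∧x≢y⇒x∈p-y; p─q⊆p)
open import Data.Vec using (_∷_; here; there)
open import Data.Product using (∃; _×_; _,_; proj₁; proj₂)
open import Relation.Nullary using (¬_; yes; no)
open import Relation.Binary.PropositionalEquality
  using (_≡_; refl; sym; trans; cong; subst)
open import Function.Bundles using (_⇔_)
open import Data.Empty using (⊥-elim)

∣p∣≡1+∣p-x∣ : ∀ {n} {p : Subset n} {x : Fin n} → x ∈ p → ∣ p ∣ ≡ suc ∣ p - x ∣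
∣p∣≡1+∣p-x∣ {p = inside ∷ p} here = cong suc (cong ∣_∣ (sym (p─⊥≡p p)))
∣p∣≡1+∣p-x∣ {p = inside ∷ p} (there x∈p) = cong suc (∣p∣≡1+∣p-x∣ x∈p)
∣p∣≡1+∣p-x∣ {p = outside ∷ p} (there x∈p) = ∣p∣≡1+∣p-x∣ x∈p

x∉p-x : ∀ {n} (p : Subset n) (x : Fin n) → x ∉ p - x
x∉p-x (s ∷ p) zero    ()
x∉p-x (s ∷ p) (suc x) (there x∈p-x) = x∉p-x p x x∈p-x

-- The image of
-- an element may depend on the proof of its membership, as it will when the
-- image is a witness extracted from a hypothesis about members of X.
record _↪_ {n : ℕ} (X R : Subset n) : Set where
  field
    image     : ∀ {x} → x ∈ X → Fin n
    image∈    : ∀ {x} (x∈X : x ∈ X) → image x∈X ∈ R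
    injective : ∀ {x y} (x∈X : x ∈ X) (y∈X : y ∈ X)
              → image x∈X ≡ image y∈X → x ≡ y

restrict : ∀ {n} {X R : Subset n} (e : X ↪ R) {x : Fin n} (x∈X : x ∈ X)
         → (X - x) ↪ (R - _↪_.image e x∈X)
restrict {X = X} e {x} x∈X = record
  { image     = λ y∈X-x → image (p─q⊆p X _ y∈X-x)
  ; image∈    = λ y∈X-x → x∈p∧x≢y⇒x∈p-y (image∈ (p─q⊆p X _ y∈X-x))
                  (λ same → x∉p-x X x (subst (_∈ X - x) (injective _ x∈X same) y∈X-x))
  ; injective = λ y∈ z∈ → injective (p─q⊆p X _ y∈) (p─q⊆p X _ z∈)
  }
  where open _↪_ e

↪⇒∣≤∣ : ∀ {n} {X R : Subset n} → X ↪ R → ∣ X ∣ ≤ ∣ R ∣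
↪⇒∣≤∣ X↪R = bounded _ refl X↪R
  where
  -- k is the size of X; it decreases by one at each removal.
  bounded : ∀ {n} k {X R : Subset n} → ∣ X ∣ ≡ k → X ↪ R → ∣ X ∣ ≤ ∣ R ∣
  bounded {n} k {X} {R} ∣X∣≡k e with nonempty? X
  ... | no X-empty =
    subst (_≤ _) (sym (trans (cong ∣_∣ (Empty-unique X-empty)) (∣⊥∣≡0 n))) z≤n
  ... | yes (x , x∈X) with k
  ...   | zero  with () ← trans (sym (∣p∣≡1+∣p-x∣ x∈X)) ∣X∣≡k
  ...   | suc k = begin
          ∣ X ∣              ≡⟨ ∣p∣≡1+∣p-x∣ x∈X ⟩
          suc ∣ X - x ∣      ≤⟨ s≤s (bounded k size (restrict e x∈X)) ⟩
          suc ∣ R - fx ∣     ≡⟨ sym (∣p∣≡1+∣p-x∣ (_↪_.image∈ e x∈X)) ⟩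
          ∣ R ∣              ∎
    where
    open ≤-Reasoning
    fx : Fin n
    fx = _↪_.image e x∈X
    size : ∣ X - x ∣ ≡ k
    size = cong pred (trans (sym (∣p∣≡1+∣p-x∣ x∈X)) ∣X∣≡k)

module _ {n : ℕ} (G : Graph n) where
  open Graph G using (Adj) renaming (sym to Adj-sym)

  _++ʷ_ : ∀ {i j u v w} → Walk G i u v → Walk G j v w → Walk G (i + j) u w
  here      ++ʷ q = q
  step uw p ++ʷ q = step uw (p ++ʷ q)

  snoc : ∀ {k u v w} → Walk G k u v → Adj v w → Walk G (suc k) u w
  snoc here        vw = step vw here
  snoc (step uw p) vw = step uw (snoc p vw)

  reverse : ∀ {k u v} → Walk G k u v → Walk G k v u
  reverse here        = here
  reverse (step uw p) = snoc (reverse p) (Adj-sym uw)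

  distLE-trans : ∀ {i j u v w} → DistLE G i u v → DistLE G j v w → DistLE G (i + j) u w
  distLE-trans (i′ , i′≤i , p) (j′ , j′≤j , q) = i′ + j′ , +-mono-≤ i′≤i j′≤j , p ++ʷ q

  distLE-sym : ∀ {k u v} → DistLE G k u v → DistLE G k v u
  distLE-sym (k′ , k′≤k , p) = k′ , k′≤k , reverse p

  Reduced : Subset n → Subset n → Set
  Reduced X R = ∀ x → x ∈ X → ∃ λ v → InN2 G x v × v ∈ R

  -- In a reduced 4-independent set, choosing for each x ∈ X a vertex of
  -- N²(x) ∩ R is injective: a shared choice v would give
  -- dist(x, y) ≤ dist(x, v) + dist(v, y) ≤ 4.
  reduced⇒↪ : ∀ {X R : Subset n} → FourIndependent G X → Reduced X R → X ↪ R
  reduced⇒↪ {X} {R} independent reduced = record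
    { image     = λ {x} x∈X → proj₁ (reduced x x∈X)
    ; image∈    = λ {x} x∈X → proj₂ (proj₂ (reduced x x∈X))
    ; injective = same-choice⇒equal
    }
    where
    near : ∀ {x} (x∈X : x ∈ X) → DistLE G 2 x (proj₁ (reduced x x∈X))
    near {x} x∈X = proj₂ (proj₁ (proj₂ (reduced x x∈X)))

    same-choice⇒equal : ∀ {x y} (x∈X : x ∈ X) (y∈X : y ∈ X)
                      → proj₁ (reduced x x∈X) ≡ proj₁ (reduced y y∈X) → x ≡ y
    same-choice⇒equal {x} {y} x∈X y∈X same with x ≟ y
    ... | yes x≡y = x≡y
    ... | no  x≢y = ⊥-elim (independent x y x∈X y∈X x≢y
          (distLE-trans (subst (DistLE G 2 x) same (near x∈X)) (distLE-sym (near y∈X))))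

mainTheorem11 : ∀ {n : ℕ} (G : Graph n) (X R : Subset n)
    → MaximalFourIndependent G X
    → (∀ v → (v ∈ R) ⇔ (¬ InClosedNbhd G X v))
    → (∀ x → x ∈ X → ∃ λ v → InN2 G x v × v ∈ R)
    → ∣ X ∣ ≤ ∣ R ∣
mainTheorem11 G X R (independent , _) _ reduced =
  ↪⇒∣≤∣ (reduced⇒↪ G independent reduced)
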